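{- Let $(\mathcal R,X,\mathcal N)$ be a digit system defined by a polynomial $P$ whose constant coefficient $p_0$ is a unit of $\mathcal E$, and suppose $(\mathcal R,X,\mathcal N)$ has the finite expansion property. Then $\mathcal R$ is finite.
   Context: Let $\mathcal E$ be a commutative ring with identity, $d\ge 1$, and $P(x)=p_dx^d+\dots+p_1x+p_0\in\mathcal E[x]$ such that $p_d$ and $p_0$ are not zero divisors of $\mathcal E$ and $\mathcal E/(p_0)$ is finite. Let $\mathcal R=\mathcal E[x]/(P)$ and let $X$ be the image of $x$ in $\mathcal R$. Let $\mathcal N\subset\mathcal R$ be a system of coset representatives of $\mathcal R/(X)$; $(\mathcal R,X,\mathcal N)$ is called a digit system. For $A\in\mathcal R$, $D_{\mathcal N}(A)$ is the unique $e\in\mathcal N$ with $A\equiv e\pmod X$ and $T(A)=\frac{A-D_{\mathcal N}(A)}{X}$ (the unique $B$ with $XB=A-D_{\mathcal N}(A)$). FEP: for every $A\in\mathcal R$ there is $n\in\mathbb N$ with $T^n(A)=0$. -}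

module Defs where

open import Level using (Level; _⊔_; Lift)
open import Algebra.Bundles using (CommutativeRing)
open import Data.Nat using (ℕ; zero; suc)
open import Data.Product using (Σ; _×_)
open import Data.List using (List; []; _∷_; map)
open import Data.List.Relation.Unary.All using (All)
open import Data.List.Relation.Unary.Any using (Any)
open import Data.Vec using (Vec; toList; head; last)

-- Polynomials over a commutative ring E, represented by coefficient lists
-- (constant coefficient first), with arithmetic and setoid equality.
module Poly {c ℓ} (E : CommutativeRing c ℓ) where
  open CommutativeRing E

  Pol : Set c
  Pol = List Carrier

  infixl 6 _⊕_
  infixl 7 _⊗_

  _⊕_ : Pol → Pol → Pol
  [] ⊕ q = q
  (a ∷ p) ⊕ [] = a ∷ p
  (a ∷ p) ⊕ (b ∷ q) = (a + b) ∷ (p ⊕ q)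

  ⊝_ : Pol → Pol
  ⊝ p = map (-_) p

  scale : Carrier → Pol → Pol
  scale a q = map (a *_) q

  _⊗_ : Pol → Pol → Pol
  [] ⊗ q = []
  (a ∷ p) ⊗ q = scale a q ⊕ (0# ∷ (p ⊗ q))

  _≈P_ : Pol → Pol → Set (c ⊔ ℓ)
  p ≈P q = All (_≈ 0#) (p ⊕ ⊝ q)

  xP : Pol
  xP = 0# ∷ 1# ∷ []

  NotZeroDivisor : Carrier → Set (c ⊔ ℓ)
  NotZeroDivisor a = ∀ b → a * b ≈ 0# → b ≈ 0#

  IsUnit : Carrier → Set (c ⊔ ℓ)
  IsUnit a = Σ Carrier λ u → a * u ≈ 1#

  QuotientFinite : Carrier → Set (c ⊔ ℓ)
  QuotientFinite a =
    Σ (List Carrier) λ L → ∀ b → Any (λ r → Σ Carrier λ t → b - r ≈ a * t) L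

-- The ring R = E[x]/(P), P = p₀ + p₁ x + … + p_d x^d given by the vector
-- (p₀ , … , p_d); elements of R are represented by polynomials, with
-- equality _≡R_ being congruence modulo P. X is represented by xP.
module DigitSystem {c ℓ} (E : CommutativeRing c ℓ) {d : ℕ}
                   (p : Vec (CommutativeRing.Carrier E) (suc d)) where
  open CommutativeRing E
  open Poly E public

  PP : Pol
  PP = toList p

  p₀ : Carrier
  p₀ = head p

  p-lead : Carrier
  p-lead = last p

  _≡R_ : Pol → Pol → Set (c ⊔ ℓ)
  A ≡R B = Σ Pol λ Q → (A ⊕ ⊝ B) ≈P (Q ⊗ PP)

  _≡modX_ : Pol → Pol → Set (c ⊔ ℓ)
  A ≡modX B = Σ Pol λ C → (A ⊕ ⊝ B) ≡R (xP ⊗ C)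

  -- N (a predicate on representatives) is a system of coset
  -- representatives of R/(X): every class mod X contains an element of N,
  -- and two elements of N congruent mod X are equal in R.
  IsDigitSet : ∀ {n} → (Pol → Set n) → Set (c ⊔ ℓ ⊔ n)
  IsDigitSet N =
    (∀ A → Σ Pol λ e → N e × (A ≡modX e)) ×
    (∀ e e′ → N e → N e′ → e ≡modX e′ → e ≡R e′)

  -- T(A) = B  (as a relation on representatives):
  -- X·B = A − e where e ∈ N, i.e. e = D_N(A)
  TStep : ∀ {n} → (Pol → Set n) → Pol → Pol → Set (c ⊔ ℓ ⊔ n)
  TStep N A B = Σ Pol λ e → N e × ((xP ⊗ B) ≡R (A ⊕ ⊝ e))

  ReachesZero : ∀ {n} → (Pol → Set n) → ℕ → Pol → Set (c ⊔ ℓ ⊔ n)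
  ReachesZero {n} N zero A = Lift n (A ≡R [])
  ReachesZero N (suc k) A = Σ Pol λ B → TStep N A B × ReachesZero N k B

  FEP : ∀ {n} → (Pol → Set n) → Set (c ⊔ ℓ ⊔ n)
  FEP N = ∀ A → Σ ℕ λ k → ReachesZero N k A

  RFinite : Set (c ⊔ ℓ)
  RFinite = Σ (List Pol) λ L → ∀ A → Any (λ B → A ≡R B) L

module Submission where

open import Defs
open import Level using (Level; lift)
open import Algebra.Bundles using (CommutativeRing)
open import Data.Nat using (ℕ; suc; _≤_)
open import Data.Vec using (Vec)
open import Data.List using (List)

open import Data.Nat using (zero; _<_; z<s; s<s)
open import Data.Nat.Properties using (m<1+n⇒m<n∨m≡n)
open import Data.Vec using (_∷_; toList)
open import Data.List using ([]; _∷_; applyUpTo)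
open import Data.List.Relation.Unary.All using (All; []; _∷_)
open import Data.List.Relation.Unary.Any using (Any)
import Data.List.Relation.Unary.Any as Any
open import Data.List.Relation.Unary.Any.Properties using (applyUpTo⁺)
open import Data.Product using (Σ; _×_; _,_; proj₁; proj₂)
open import Data.Sum using (inj₁; inj₂)
open import Data.Maybe using (nothing)
open import Relation.Binary.Definitions using (Reflexive; Transitive)
import Relation.Binary.PropositionalEquality as ≡
open import Algebra.Solver.Ring.AlmostCommutativeRing
  using (fromCommutativeRing; -raw-almostCommutative⟶)

-- Since p₀ is a unit, X is a unit of R (P ≡ 0 gives X·(−p₀⁻¹(p₁ + … +
-- p_d X^{d-1})) = 1), so (X) = R and all digits are congruent to one digit
-- e₀.  A step T(A) = B therefore says exactly A = S(B) with S(B) = X·B + e₀,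
-- and FEP says that every A equals Sᵏ(0) for some k.  Applying this to the
-- element B₁ = −e₀/X gives B₁ = Sᵐ(0), hence Sᵐ⁺¹(0) = X·B₁ + e₀ = 0: the
-- orbit of 0 under S is periodic, so R = {S⁰(0), …, Sᵐ(0)} is finite.

module Coefficients {c ℓ} (E : CommutativeRing c ℓ) where
  open CommutativeRing E hiding (zero)
  open Poly E
  open import Algebra.Solver.Ring (CommutativeRing.rawRing E)
    (fromCommutativeRing E) (-raw-almostCommutative⟶ (fromCommutativeRing E))
    (λ _ _ → nothing)
  open import Algebra.Properties.Ring ring using (-0#≈0#; -‿distribˡ-*)
  open import Algebra.Properties.AbelianGroup +-abelianGroup using (⁻¹-∙-comm)
  open import Relation.Binary.Reasoning.Setoid setoid

  coeff : Pol → ℕ → Carrier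
  coeff [] _ = 0#
  coeff (a ∷ p) zero = a
  coeff (a ∷ p) (suc i) = coeff p i

  cf-⊕ : ∀ p q i → coeff (p ⊕ q) i ≈ coeff p i + coeff q i
  cf-⊕ [] q i = sym (+-identityˡ _)
  cf-⊕ (a ∷ p) [] i = sym (+-identityʳ _)
  cf-⊕ (a ∷ p) (b ∷ q) zero = refl
  cf-⊕ (a ∷ p) (b ∷ q) (suc i) = cf-⊕ p q i

  cf-⊝ : ∀ p i → coeff (⊝ p) i ≈ - coeff p i
  cf-⊝ [] i = sym -0#≈0#
  cf-⊝ (a ∷ p) zero = refl
  cf-⊝ (a ∷ p) (suc i) = cf-⊝ p i

  cf-scale : ∀ a p i → coeff (scale a p) i ≈ a * coeff p i
  cf-scale a [] i = sym (zeroʳ a)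
  cf-scale a (b ∷ p) zero = refl
  cf-scale a (b ∷ p) (suc i) = cf-scale a p i

  cf-⊗-zero : ∀ a Q M → coeff ((a ∷ Q) ⊗ M) zero ≈ a * coeff M zero
  cf-⊗-zero a Q M = begin
    coeff (scale a M ⊕ (0# ∷ (Q ⊗ M))) zero ≈⟨ cf-⊕ (scale a M) _ zero ⟩
    coeff (scale a M) zero + 0#              ≈⟨ +-identityʳ _ ⟩
    coeff (scale a M) zero                   ≈⟨ cf-scale a M zero ⟩
    a * coeff M zero                         ∎

  cf-⊗-suc : ∀ a Q M i →
    coeff ((a ∷ Q) ⊗ M) (suc i) ≈ a * coeff M (suc i) + coeff (Q ⊗ M) i
  cf-⊗-suc a Q M i = trans (cf-⊕ (scale a M) _ (suc i))
                           (+-cong (cf-scale a M (suc i)) refl)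

  ⊗-distribʳ-⊕ : ∀ Q Q′ M i →
    coeff ((Q ⊕ Q′) ⊗ M) i ≈ coeff (Q ⊗ M) i + coeff (Q′ ⊗ M) i
  ⊗-distribʳ-⊕ [] Q′ M i = sym (+-identityˡ _)
  ⊗-distribʳ-⊕ (a ∷ Q) [] M i = sym (+-identityʳ _)
  ⊗-distribʳ-⊕ (a ∷ Q) (b ∷ Q′) M zero = begin
    coeff (((a + b) ∷ (Q ⊕ Q′)) ⊗ M) zero ≈⟨ cf-⊗-zero (a + b) (Q ⊕ Q′) M ⟩
    (a + b) * coeff M zero                ≈⟨ distribʳ _ a b ⟩
    a * coeff M zero + b * coeff M zero
      ≈⟨ sym (+-cong (cf-⊗-zero a Q M) (cf-⊗-zero b Q′ M)) ⟩
    coeff ((a ∷ Q) ⊗ M) zero + coeff ((b ∷ Q′) ⊗ M) zero ∎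
  ⊗-distribʳ-⊕ (a ∷ Q) (b ∷ Q′) M (suc i) = begin
    coeff (((a + b) ∷ (Q ⊕ Q′)) ⊗ M) (suc i) ≈⟨ cf-⊗-suc (a + b) (Q ⊕ Q′) M i ⟩
    (a + b) * m + coeff ((Q ⊕ Q′) ⊗ M) i     ≈⟨ +-cong refl (⊗-distribʳ-⊕ Q Q′ M i) ⟩
    (a + b) * m + (coeff (Q ⊗ M) i + coeff (Q′ ⊗ M) i)
      ≈⟨ solve 5 (λ a b m s t → (a :+ b) :* m :+ (s :+ t) := (a :* m :+ s) :+ (b :* m :+ t))
               refl a b m _ _ ⟩
    (a * m + coeff (Q ⊗ M) i) + (b * m + coeff (Q′ ⊗ M) i)
      ≈⟨ sym (+-cong (cf-⊗-suc a Q M i) (cf-⊗-suc b Q′ M i)) ⟩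
    coeff ((a ∷ Q) ⊗ M) (suc i) + coeff ((b ∷ Q′) ⊗ M) (suc i) ∎
    where m = coeff M (suc i)

  ⊗-⊝ : ∀ Q M i → coeff ((⊝ Q) ⊗ M) i ≈ - coeff (Q ⊗ M) i
  ⊗-⊝ [] M i = sym -0#≈0#
  ⊗-⊝ (a ∷ Q) M zero = begin
    coeff ((- a ∷ ⊝ Q) ⊗ M) zero ≈⟨ cf-⊗-zero (- a) (⊝ Q) M ⟩
    - a * coeff M zero           ≈⟨ sym (-‿distribˡ-* a _) ⟩
    - (a * coeff M zero)         ≈⟨ -‿cong (sym (cf-⊗-zero a Q M)) ⟩
    - coeff ((a ∷ Q) ⊗ M) zero   ∎
  ⊗-⊝ (a ∷ Q) M (suc i) = begin
    coeff ((- a ∷ ⊝ Q) ⊗ M) (suc i) ≈⟨ cf-⊗-suc (- a) (⊝ Q) M i ⟩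
    - a * m + coeff ((⊝ Q) ⊗ M) i   ≈⟨ +-cong refl (⊗-⊝ Q M i) ⟩
    - a * m + - coeff (Q ⊗ M) i     ≈⟨ +-cong (sym (-‿distribˡ-* a m)) refl ⟩
    - (a * m) + - coeff (Q ⊗ M) i   ≈⟨ ⁻¹-∙-comm _ _ ⟩
    - (a * m + coeff (Q ⊗ M) i)     ≈⟨ -‿cong (sym (cf-⊗-suc a Q M i)) ⟩
    - coeff ((a ∷ Q) ⊗ M) (suc i)   ∎
    where m = coeff M (suc i)

  ⊗-scale : ∀ k Q M i → coeff (scale k Q ⊗ M) i ≈ k * coeff (Q ⊗ M) i
  ⊗-scale k [] M i = sym (zeroʳ k)
  ⊗-scale k (a ∷ Q) M zero = begin
    coeff ((k * a ∷ scale k Q) ⊗ M) zero ≈⟨ cf-⊗-zero (k * a) (scale k Q) M ⟩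
    k * a * coeff M zero                 ≈⟨ *-assoc k a _ ⟩
    k * (a * coeff M zero)               ≈⟨ *-cong refl (sym (cf-⊗-zero a Q M)) ⟩
    k * coeff ((a ∷ Q) ⊗ M) zero         ∎
  ⊗-scale k (a ∷ Q) M (suc i) = begin
    coeff ((k * a ∷ scale k Q) ⊗ M) (suc i) ≈⟨ cf-⊗-suc (k * a) (scale k Q) M i ⟩
    k * a * m + coeff (scale k Q ⊗ M) i     ≈⟨ +-cong refl (⊗-scale k Q M i) ⟩
    k * a * m + k * coeff (Q ⊗ M) i         ≈⟨ +-cong (*-assoc k a m) refl ⟩
    k * (a * m) + k * coeff (Q ⊗ M) i       ≈⟨ sym (distribˡ k _ _) ⟩
    k * (a * m + coeff (Q ⊗ M) i)           ≈⟨ *-cong refl (sym (cf-⊗-suc a Q M i)) ⟩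
    k * coeff ((a ∷ Q) ⊗ M) (suc i)         ∎
    where m = coeff M (suc i)

  ⊗-identityˡ : ∀ M i → coeff ((1# ∷ []) ⊗ M) i ≈ coeff M i
  ⊗-identityˡ M zero = trans (cf-⊗-zero 1# [] M) (*-identityˡ _)
  ⊗-identityˡ M (suc i) =
    trans (cf-⊗-suc 1# [] M i) (trans (+-identityʳ _) (*-identityˡ _))

  xP⊗ : ∀ B i → coeff (xP ⊗ B) i ≈ coeff (0# ∷ B) i
  xP⊗ B zero = trans (cf-⊗-zero 0# (1# ∷ []) B) (zeroˡ _)
  xP⊗ B (suc i) = begin
    coeff (xP ⊗ B) (suc i)                         ≈⟨ cf-⊗-suc 0# (1# ∷ []) B i ⟩
    0# * coeff B (suc i) + coeff ((1# ∷ []) ⊗ B) i ≈⟨ +-cong (zeroˡ _) (⊗-identityˡ B i) ⟩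
    0# + coeff B i                                 ≈⟨ +-identityˡ _ ⟩
    coeff B i                                      ∎

  coeffs-zero⇒All : ∀ p → (∀ i → coeff p i ≈ 0#) → All (_≈ 0#) p
  coeffs-zero⇒All [] h = []
  coeffs-zero⇒All (a ∷ p) h = h zero ∷ coeffs-zero⇒All p (λ i → h (suc i))

  All⇒coeffs-zero : ∀ {p} → All (_≈ 0#) p → ∀ i → coeff p i ≈ 0#
  All⇒coeffs-zero [] i = refl
  All⇒coeffs-zero (z ∷ _) zero = z
  All⇒coeffs-zero (_ ∷ zs) (suc i) = All⇒coeffs-zero zs i

  cf-difference : ∀ A B C i →
    coeff ((A ⊕ ⊝ B) ⊕ ⊝ C) i ≈ (coeff A i + - coeff B i) + - coeff C i
  cf-difference A B C i =
    trans (cf-⊕ (A ⊕ ⊝ B) _ i)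
          (+-cong (trans (cf-⊕ A (⊝ B) i) (+-cong refl (cf-⊝ B i))) (cf-⊝ C i))

  x+y-y≈x : ∀ x y → (x + y) + - y ≈ x
  x+y-y≈x x y = trans (+-assoc x y (- y)) (trans (+-cong refl (-‿inverseʳ y)) (+-identityʳ x))

  x-y+y≈x : ∀ x y → (x + - y) + y ≈ x
  x-y+y≈x x y = trans (+-assoc x (- y) y) (trans (+-cong refl (-‿inverseˡ y)) (+-identityʳ x))

  sum⇒difference-zero : ∀ {a b q} → a ≈ b + q → (a + - b) + - q ≈ 0#
  sum⇒difference-zero {a} {b} {q} a≈b+q = begin
    (a + - b) + - q       ≈⟨ +-cong (+-cong (trans a≈b+q (+-comm b q)) refl) refl ⟩
    (q + b + - b) + - q   ≈⟨ +-cong (x+y-y≈x q b) refl ⟩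
    q + - q               ≈⟨ -‿inverseʳ q ⟩
    0#                    ∎

  difference-zero⇒sum : ∀ {a b q} → (a + - b) + - q ≈ 0# → a ≈ b + q
  difference-zero⇒sum {a} {b} {q} d≈0 = begin
    a                            ≈⟨ sym (x-y+y≈x a b) ⟩
    (a + - b) + b                ≈⟨ +-cong (sym (x-y+y≈x (a + - b) q)) refl ⟩
    ((a + - b) + - q + q) + b    ≈⟨ +-cong (+-cong d≈0 refl) refl ⟩
    (0# + q) + b                 ≈⟨ trans (+-cong (+-identityˡ q) refl) (+-comm q b) ⟩
    b + q                        ∎

module Orbit {a r} {A : Set a} (_~_ : A → A → Set r)
             (~-refl : Reflexive _~_) (~-trans : Transitive _~_)
             (S : A → A) (S-cong : ∀ {x y} → x ~ y → S x ~ S y) where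

  iter : ℕ → A → A
  iter zero x = x
  iter (suc k) x = S (iter k x)

  -- by induction on k, reducing Sᵐ⁺¹(z) back to z whenever it occurs
  periodic-orbit : ∀ z m → iter (suc m) z ~ z →
                   ∀ k → Σ ℕ λ j → j < suc m × iter k z ~ iter j z
  periodic-orbit z m period zero = zero , z<s , ~-refl
  periodic-orbit z m period (suc k) with periodic-orbit z m period k
  ... | j , j<1+m , r with m<1+n⇒m<n∨m≡n j<1+m
  ...   | inj₁ j<m = suc j , s<s j<m , S-cong r
  ...   | inj₂ ≡.refl = zero , z<s , ~-trans (S-cong r) period

  orbit-covers : ∀ z m → iter (suc m) z ~ z → ∀ x k → x ~ iter k z →
                 Any (x ~_) (applyUpTo (λ j → iter j z) (suc m))
  orbit-covers z m period x k x~Sᵏz with periodic-orbit z m period k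
  ... | j , j<1+m , r = applyUpTo⁺ (λ j → iter j z) (~-trans x~Sᵏz r) j<1+m

module Congruence {c ℓ} (E : CommutativeRing c ℓ) {d : ℕ}
                  (p : Vec (CommutativeRing.Carrier E) (suc d)) where
  open CommutativeRing E hiding (zero)
  open DigitSystem E p
  open Coefficients E public
  open import Algebra.Solver.Ring (CommutativeRing.rawRing E)
    (fromCommutativeRing E) (-raw-almostCommutative⟶ (fromCommutativeRing E))
    (λ _ _ → nothing)
  open import Relation.Binary.Reasoning.Setoid setoid

  infix 4 _≈ᴿ_

  record _≈ᴿ_ (A B : Pol) : Set (c Level.⊔ ℓ) where
    constructor _,_
    field
      quotient : Pol
      equation : ∀ i → coeff A i ≈ coeff B i + coeff (quotient ⊗ PP) i

  ≗⇒≈ᴿ : ∀ {A B} → (∀ i → coeff A i ≈ coeff B i) → A ≈ᴿ B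
  ≗⇒≈ᴿ h = [] , λ i → trans (h i) (sym (+-identityʳ _))

  ≈ᴿ-refl : ∀ {A} → A ≈ᴿ A
  ≈ᴿ-refl = ≗⇒≈ᴿ (λ i → refl)

  ≈ᴿ-sym : ∀ {A B} → A ≈ᴿ B → B ≈ᴿ A
  ≈ᴿ-sym {A} {B} (Q , h) = ⊝ Q , λ i → begin
    coeff B i ≈⟨ sym (x+y-y≈x _ _) ⟩
    (coeff B i + coeff (Q ⊗ PP) i) + - coeff (Q ⊗ PP) i ≈⟨ +-cong (sym (h i)) (sym (⊗-⊝ Q PP i)) ⟩
    coeff A i + coeff ((⊝ Q) ⊗ PP) i ∎

  ≈ᴿ-trans : ∀ {A B C} → A ≈ᴿ B → B ≈ᴿ C → A ≈ᴿ C
  ≈ᴿ-trans {A} {B} {C} (Q , h) (Q′ , h′) = Q′ ⊕ Q , λ i → begin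
    coeff A i                                             ≈⟨ h i ⟩
    coeff B i + coeff (Q ⊗ PP) i                          ≈⟨ +-cong (h′ i) refl ⟩
    (coeff C i + coeff (Q′ ⊗ PP) i) + coeff (Q ⊗ PP) i    ≈⟨ +-assoc _ _ _ ⟩
    coeff C i + (coeff (Q′ ⊗ PP) i + coeff (Q ⊗ PP) i)    ≈⟨ +-cong refl (sym (⊗-distribʳ-⊕ Q′ Q PP i)) ⟩
    coeff C i + coeff ((Q′ ⊕ Q) ⊗ PP) i                   ∎

  ⊕-cong : ∀ {A B C D} → A ≈ᴿ B → C ≈ᴿ D → A ⊕ C ≈ᴿ B ⊕ D
  ⊕-cong {A} {B} {C} {D} (Q , h) (Q′ , h′) = Q ⊕ Q′ , λ i → begin
    coeff (A ⊕ C) i                                   ≈⟨ cf-⊕ A C i ⟩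
    coeff A i + coeff C i                             ≈⟨ +-cong (h i) (h′ i) ⟩
    (coeff B i + coeff (Q ⊗ PP) i) + (coeff D i + coeff (Q′ ⊗ PP) i)
      ≈⟨ solve 4 (λ b q e r → (b :+ q) :+ (e :+ r) := (b :+ e) :+ (q :+ r)) refl _ _ _ _ ⟩
    (coeff B i + coeff D i) + (coeff (Q ⊗ PP) i + coeff (Q′ ⊗ PP) i)
      ≈⟨ +-cong (sym (cf-⊕ B D i)) (sym (⊗-distribʳ-⊕ Q Q′ PP i)) ⟩
    coeff (B ⊕ D) i + coeff ((Q ⊕ Q′) ⊗ PP) i         ∎

  scale-cong : ∀ k {A B} → A ≈ᴿ B → scale k A ≈ᴿ scale k B
  scale-cong k {A} {B} (Q , h) = scale k Q , λ i → begin
    coeff (scale k A) i                    ≈⟨ cf-scale k A i ⟩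
    k * coeff A i                          ≈⟨ *-cong refl (h i) ⟩
    k * (coeff B i + coeff (Q ⊗ PP) i)     ≈⟨ distribˡ k _ _ ⟩
    k * coeff B i + k * coeff (Q ⊗ PP) i   ≈⟨ +-cong (sym (cf-scale k B i)) (sym (⊗-scale k Q PP i)) ⟩
    coeff (scale k B) i + coeff (scale k Q ⊗ PP) i ∎

  shift-cong : ∀ {A B} → A ≈ᴿ B → (0# ∷ A) ≈ᴿ (0# ∷ B)
  shift-cong {A} {B} (Q , h) = 0# ∷ Q , shifted
    where
    shifted : ∀ i → coeff (0# ∷ A) i ≈ coeff (0# ∷ B) i + coeff ((0# ∷ Q) ⊗ PP) i
    shifted zero = begin
      0#                                     ≈⟨ sym (trans (+-identityˡ _) (zeroˡ _)) ⟩
      0# + 0# * coeff PP zero                ≈⟨ +-cong refl (sym (cf-⊗-zero 0# Q PP)) ⟩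
      0# + coeff ((0# ∷ Q) ⊗ PP) zero        ∎
    shifted (suc i) = begin
      coeff A i                                    ≈⟨ h i ⟩
      coeff B i + coeff (Q ⊗ PP) i
        ≈⟨ +-cong refl (sym (trans (+-cong (zeroˡ _) refl) (+-identityˡ _))) ⟩
      coeff B i + (0# * coeff PP (suc i) + coeff (Q ⊗ PP) i)
        ≈⟨ +-cong refl (sym (cf-⊗-suc 0# Q PP i)) ⟩
      coeff B i + coeff ((0# ∷ Q) ⊗ PP) (suc i)    ∎

  P≈ᴿ0 : PP ≈ᴿ []
  P≈ᴿ0 = (1# ∷ []) , λ i → trans (sym (⊗-identityˡ PP i)) (sym (+-identityˡ _))

  ≈ᴿ⇒≡R : ∀ {A B} → A ≈ᴿ B → A ≡R B
  ≈ᴿ⇒≡R {A} {B} (Q , h) = Q , coeffs-zero⇒All _ λ i →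
    trans (cf-difference A B (Q ⊗ PP) i) (sum⇒difference-zero (h i))

  ≡R⇒≈ᴿ : ∀ {A B} → A ≡R B → A ≈ᴿ B
  ≡R⇒≈ᴿ {A} {B} (Q , z) = Q , λ i →
    difference-zero⇒sum (trans (sym (cf-difference A B (Q ⊗ PP) i)) (All⇒coeffs-zero z i))

module UnitConstantTerm {c ℓ} (E : CommutativeRing c ℓ) {d : ℕ}
                        (p₀ : CommutativeRing.Carrier E)
                        (ps : Vec (CommutativeRing.Carrier E) d)
                        (u : CommutativeRing.Carrier E)
                        (p₀u≈1 : CommutativeRing._≈_ E (CommutativeRing._*_ E p₀ u)
                                                       (CommutativeRing.1# E)) where
  open CommutativeRing E hiding (zero)
  open DigitSystem E (p₀ ∷ ps) hiding (p₀)
  open Congruence E (p₀ ∷ ps) public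

  -- X is a unit of R: every A is X·C.  For A = a + x·A′ take
  -- C = A′ − a·u·(p₁ + p₂x + …), so that X·C = A − a·u·P ≡ A.
  X-divides : ∀ A → Σ Pol λ C → (0# ∷ C) ≈ᴿ A
  X-divides [] = [] , ≗⇒≈ᴿ constant-zero
    where
    constant-zero : ∀ i → coeff (0# ∷ []) i ≈ 0#
    constant-zero zero = refl
    constant-zero (suc i) = refl
  X-divides (a ∷ A′) =
    C , ≈ᴿ-trans (≗⇒≈ᴿ XC≗) (⊕-cong (scale-cong k P≈ᴿ0) (≈ᴿ-refl {a ∷ A′}))
    where
    k = a * - u
    C = scale k (toList ps) ⊕ A′
    -- the constant coefficient of k·P + A vanishes because p₀u = 1
    constant-cancels : 0# ≈ k * p₀ + a
    constant-cancels = sym (begin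
      a * - u * p₀ + a          ≈⟨ +-cong (*-cong (sym (-‿distribʳ-* a u)) refl) refl ⟩
      - (a * u) * p₀ + a        ≈⟨ +-cong (sym (-‿distribˡ-* (a * u) p₀)) refl ⟩
      - (a * u * p₀) + a        ≈⟨ +-cong (-‿cong a·u·p₀≈a) refl ⟩
      - a + a                   ≈⟨ -‿inverseˡ a ⟩
      0#                        ∎)
      where
      open import Relation.Binary.Reasoning.Setoid setoid
      open import Algebra.Properties.Ring ring using (-‿distribˡ-*; -‿distribʳ-*)
      a·u·p₀≈a : a * u * p₀ ≈ a
      a·u·p₀≈a = begin
        a * u * p₀    ≈⟨ trans (*-assoc a u p₀) (*-cong refl (*-comm u p₀)) ⟩
        a * (p₀ * u)  ≈⟨ *-cong refl p₀u≈1 ⟩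
        a * 1#        ≈⟨ *-identityʳ a ⟩
        a             ∎
    XC≗ : ∀ i → coeff (0# ∷ C) i ≈ coeff (scale k (p₀ ∷ toList ps) ⊕ (a ∷ A′)) i
    XC≗ zero = constant-cancels
    XC≗ (suc i) = refl

  module Digits {n} (N : Pol → Set n) (D : IsDigitSet N) where

    e₀ : Pol
    e₀ = proj₁ (proj₁ D [])

    e₀∈N : N e₀
    e₀∈N = proj₁ (proj₂ (proj₁ D []))

    -- since (X) = R, all digits are congruent to e₀
    digit≈e₀ : ∀ {e} → N e → e ≈ᴿ e₀
    digit≈e₀ {e} e∈N = ≡R⇒≈ᴿ (proj₂ D e e₀ e∈N e₀∈N (C , ≈ᴿ⇒≡R XC≈diff))
      where
      C = proj₁ (X-divides (e ⊕ ⊝ e₀))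
      XC≈diff : e ⊕ ⊝ e₀ ≈ᴿ xP ⊗ C
      XC≈diff = ≈ᴿ-sym (≈ᴿ-trans (≗⇒≈ᴿ (xP⊗ C)) (proj₂ (X-divides (e ⊕ ⊝ e₀))))

    -- the inverse of T: S(B) = X·B + e₀
    S : Pol → Pol
    S B = (0# ∷ B) ⊕ e₀

    S-cong : ∀ {A B} → A ≈ᴿ B → S A ≈ᴿ S B
    S-cong A≈B = ⊕-cong (shift-cong A≈B) (≈ᴿ-refl {e₀})

    open Orbit _≈ᴿ_ ≈ᴿ-refl ≈ᴿ-trans S S-cong public

    T-inverse : ∀ {A B} → TStep N A B → A ≈ᴿ S B
    T-inverse {A} {B} (e , e∈N , XB≡A-e) =
      ≈ᴿ-trans (≗⇒≈ᴿ A≗A-e+e)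
        (⊕-cong (≈ᴿ-trans (≈ᴿ-sym (≡R⇒≈ᴿ {xP ⊗ B} {A ⊕ ⊝ e} XB≡A-e)) (≗⇒≈ᴿ (xP⊗ B))) (digit≈e₀ e∈N))
      where
      A≗A-e+e : ∀ i → coeff A i ≈ coeff ((A ⊕ ⊝ e) ⊕ e) i
      A≗A-e+e i = sym (trans (cf-⊕ (A ⊕ ⊝ e) e i)
        (trans (+-cong (trans (cf-⊕ A (⊝ e) i) (+-cong refl (cf-⊝ e i))) refl)
               (x-y+y≈x (coeff A i) (coeff e i))))

    expansion : ∀ k A → ReachesZero N k A → A ≈ᴿ iter k []
    expansion zero A (lift A≡0) = ≡R⇒≈ᴿ A≡0
    expansion (suc k) A (B , step , rest) =
      ≈ᴿ-trans (T-inverse step) (S-cong (expansion k B rest))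

    -- with FEP the orbit of 0 is periodic: if X·B₁ = −e₀ and B₁ = Sᵐ(0),
    -- then Sᵐ⁺¹(0) = X·B₁ + e₀ = 0
    zero-periodic : FEP N → Σ ℕ λ m → iter (suc m) [] ≈ᴿ []
    zero-periodic fep = m , (begin
      S (iter m [])     ∼⟨ S-cong (≈ᴿ-sym (expansion m B₁ B₁-expansion)) ⟩
      S B₁              ∼⟨ ⊕-cong (proj₂ (X-divides (⊝ e₀))) ≈ᴿ-refl ⟩
      ⊝ e₀ ⊕ e₀         ∼⟨ ≗⇒≈ᴿ (λ i → trans (cf-⊕ (⊝ e₀) e₀ i)
                                    (trans (+-cong (cf-⊝ e₀ i) refl) (-‿inverseˡ _))) ⟩
      []                ∎)
      where
      open import Relation.Binary.Reasoning.Base.Single _≈ᴿ_ ≈ᴿ-refl ≈ᴿ-trans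
      B₁ = proj₁ (X-divides (⊝ e₀))
      m = proj₁ (fep B₁)
      B₁-expansion = proj₂ (fep B₁)

lemma2p12 : ∀ {c ℓ n} (E : CommutativeRing c ℓ) (d : ℕ) → 1 ≤ d →
    (p : Vec (CommutativeRing.Carrier E) (suc d)) →
    DigitSystem.NotZeroDivisor E p (DigitSystem.p-lead E p) →
    DigitSystem.NotZeroDivisor E p (DigitSystem.p₀ E p) →
    DigitSystem.QuotientFinite E p (DigitSystem.p₀ E p) →
    (N : List (CommutativeRing.Carrier E) → Set n) →
    DigitSystem.IsDigitSet E p N →
    DigitSystem.IsUnit E p (DigitSystem.p₀ E p) →
    DigitSystem.FEP E p N →
    DigitSystem.RFinite E p
lemma2p12 E d _ (p₀ ∷ ps) _ _ _ N D (u , p₀u≈1) fep =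
  applyUpTo (λ j → iter j []) (suc m) , covered
  where
  open UnitConstantTerm E p₀ ps u p₀u≈1
  open Digits N D
  m = proj₁ (zero-periodic fep)

  covered : ∀ A → Any (DigitSystem._≡R_ E (p₀ ∷ ps) A) (applyUpTo (λ j → iter j []) (suc m))
  covered A = Any.map ≈ᴿ⇒≡R
    (orbit-covers [] m (proj₂ (zero-periodic fep)) A k (expansion k A (proj₂ (fep A))))
    where k = proj₁ (fep A)
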